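{- For any $X\subseteq V$, there exists a set $Y\subseteq V$ such that $Y$ mutually covers $X$ and \[ |Y|\le\frac{|N(X)|}{d}\,(1+\ln d). \]
   Context: $\mathcal{B}_d$ is the subgraph of the Hamming cube $Q_{2d-1}$ induced on the two middle layers $\mathcal{L}_{d-1}\cup\mathcal{L}_d$ (vectors in $\{0,1\}^{2d-1}$ with $d-1$ or $d$ ones); $V$ is its vertex set. $N(X)$ is the set of vertices of $\mathcal{B}_d$ adjacent to some vertex of $X$. $Y$ covers $X$ if $X\subseteq N(Y)$, and $Y$ mutually covers $X$ if $X\subseteq N(Y)$ and $Y\subseteq N(X)$. $\ln$ is the natural logarithm. -}

module Defs where

open import Data.Bool using (Bool; true; false; _∧_; if_then_else_)
open import Data.Nat using (ℕ; zero; suc; _+_; _*_; _∸_; _^_; _!; _≤_; _≡ᵇ_)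
open import Data.Nat.Properties using (_!≢0)
open import Data.List using (List; []; _∷_; map; _++_; filter; length)
open import Data.Bool.ListAction using (any)
open import Data.Vec using (Vec; []; _∷_)
open import Data.Integer using (+_)
import Data.Rational as ℚ
open import Relation.Binary.PropositionalEquality using (_≡_)
open import Relation.Nullary.Decidable using (T?)

Word : ℕ → Set
Word m = Vec Bool m

allWords : (m : ℕ) → List (Word m)
allWords zero    = [] ∷ []
allWords (suc m) = map (false ∷_) (allWords m) ++ map (true ∷_) (allWords m)

weight : ∀ {m} → Word m → ℕ
weight []            = 0
weight (false ∷ v)   = weight v
weight (true  ∷ v)   = suc (weight v)

hamming : ∀ {m} → Word m → Word m → ℕ
hamming []      []      = 0
hamming (true  ∷ u) (true  ∷ v) = hamming u v
hamming (false ∷ u) (false ∷ v) = hamming u v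
hamming (true  ∷ u) (false ∷ v) = suc (hamming u v)
hamming (false ∷ u) (true  ∷ v) = suc (hamming u v)

dim : ℕ → ℕ
dim d = 2 * d ∸ 1

inV : (d : ℕ) → Word (dim d) → Bool
inV d v = if weight v ≡ᵇ (d ∸ 1) then true else (weight v ≡ᵇ d)

adj : (d : ℕ) → Word (dim d) → Word (dim d) → Bool
adj d u v = inV d u ∧ (inV d v ∧ (hamming u v ≡ᵇ 1))

VSet : ℕ → Set
VSet d = Word (dim d) → Bool

Mem : (d : ℕ) → Word (dim d) → VSet d → Set
Mem d v S = S v ≡ true

Sub : (d : ℕ) → VSet d → VSet d → Set
Sub d S T = ∀ (v : Word (dim d)) → Mem d v S → Mem d v T

V : (d : ℕ) → VSet d
V d = inV d

card : (d : ℕ) → VSet d → ℕ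
card d S = length (filter (λ v → T? (S v)) (allWords (dim d)))

N : (d : ℕ) → VSet d → VSet d
N d X v = any (λ u → X u ∧ adj d u v) (allWords (dim d))

Covers : (d : ℕ) → VSet d → VSet d → Set
Covers d Y X = Sub d X (N d Y)

MutuallyCovers : (d : ℕ) → VSet d → VSet d → Set
MutuallyCovers d Y X = Sub d X (N d Y) × Sub d Y (N d X)
  where open import Data.Product using (_×_)

-- Real-number comparison without reals.
-- expPartial k n = Σ_{j=0}^{n} k^j / j!   (partial sums of the series of e^k)

expPartial : ℕ → ℕ → ℚ.ℚ
expPartial k zero    = ℚ.1ℚ
expPartial k (suc n) = expPartial k n ℚ.+ ((+ (k ^ suc n)) ℚ./ (suc n !)) {{suc n !≢0}}

-- ExpLe k M  ⇔  e^k ≤ M   (e^k is the supremum of its partial sums)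
ExpLe : ℕ → ℕ → Set
ExpLe k M = ∀ (n : ℕ) → expPartial k n ℚ.≤ ((+ M) ℚ./ 1)

-- LeOnePlusLn a b d  ⇔  a ≤ b · (1 + ln d)      (for d ≥ 1)
-- Indeed a ≤ b + b·ln d  ⇔  a ∸ b ≤ b·ln d  ⇔  e^(a ∸ b) ≤ d^b
-- (if a ≤ b both sides hold trivially since d^b ≥ 1).
LeOnePlusLn : ℕ → ℕ → ℕ → Set
LeOnePlusLn a b d = ExpLe (a ∸ b) (d ^ b)

module Submission where

-- Greedy covering with a harmonic potential, followed by H_d − 1 ≤ ln d.
--
-- While some part U of X is still uncovered, add to Y a vertex y maximising the codegree
-- a_U(y) = |N(y) ∩ U|, say a_U(y) = c, and remove its c neighbours from U. The potential
-- Ψ(U) = Σ_y H(a_U(y)) (H the harmonic numbers) then drops by at least d: every codegree is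
-- at most c, so each unit by which a codegree drops costs at least 1/c, and the codegrees
-- drop by d·c in total because each removed vertex has degree d. Hence d|Y| ≤ Ψ(X) ≤ |N(X)|·H_d.
--
-- It remains to see e^(H_d − 1) ≤ d for the partial sums of the exponential series: they are
-- submultiplicative (the Cauchy product of the series of e^x and e^y is that of e^(x+y)), and
-- comparison with a geometric series gives e^(1/j) ≤ j/(j−1), which telescopes to d.

module Cube where

  open import Function using (_∘_)
  open import Function.Bundles using (Equivalence)
  open import Data.Bool using (Bool; true; false; _∧_; _∨_)
  open import Data.Bool.Properties using (T-≡; ∧-identityʳ)
  open import Data.Bool.ListAction using (any)
  open import Data.Nat
  open import Data.Nat.Properties
  open import Data.Nat.ListAction using (sum)
  open import Data.Nat.ListAction.Properties using (sum-++)
  open import Data.Nat.Solver using (module +-*-Solver)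
  open import Data.List using ([]; _∷_; map; _++_; filter; length)
  open import Data.List.Properties using (map-++; map-∘)
  open import Data.List.Membership.Propositional using (_∈_; lose)
  open import Data.List.Membership.Propositional.Properties using (∈-map⁺; ∈-++⁺ˡ; ∈-++⁺ʳ)
  open import Data.List.Relation.Unary.Any using (here; satisfied)
  open import Data.List.Relation.Unary.Any.Properties using (any⁺; any⁻)
  import Data.List.Relation.Unary.All as All
  open import Data.List.Extrema.Nat using (argmax; f[xs]≤f[argmax])
  open import Data.Vec using ([]; _∷_; replicate)
  open import Data.Product using (∃-syntax; _×_; _,_)
  open import Data.Sum using (_⊎_; inj₁; inj₂)
  open import Algebra.Properties.CommutativeSemigroup +-commutativeSemigroup
    using () renaming (interchange to +-interchange)
  open import Relation.Binary.PropositionalEquality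
  open import Relation.Nullary.Decidable using (T?)
  open import Defs using (Word; allWords; weight; hamming; dim; VSet; card)
  open +-*-Solver using (solve; _:+_; _:*_; _:=_)

  private variable
    m : ℕ

  𝟙 : Bool → ℕ
  𝟙 true  = 1
  𝟙 false = 0

  sumWords : (m : ℕ) → (Word m → ℕ) → ℕ
  sumWords zero    f = f []
  sumWords (suc m) f = sumWords m (f ∘ (false ∷_)) + sumWords m (f ∘ (true ∷_))

  sumWords-cong : ∀ m {f g : Word m → ℕ} → (∀ v → f v ≡ g v) → sumWords m f ≡ sumWords m g
  sumWords-cong zero    f≡g = f≡g []
  sumWords-cong (suc m) f≡g =
    cong₂ _+_ (sumWords-cong m (f≡g ∘ (false ∷_))) (sumWords-cong m (f≡g ∘ (true ∷_)))

  sumWords-mono-≤ : ∀ m {f g : Word m → ℕ} → (∀ v → f v ≤ g v) → sumWords m f ≤ sumWords m g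
  sumWords-mono-≤ zero    f≤g = f≤g []
  sumWords-mono-≤ (suc m) f≤g =
    +-mono-≤ (sumWords-mono-≤ m (f≤g ∘ (false ∷_))) (sumWords-mono-≤ m (f≤g ∘ (true ∷_)))

  sumWords-+ : ∀ m (f g : Word m → ℕ) → sumWords m (λ v → f v + g v) ≡ sumWords m f + sumWords m g
  sumWords-+ zero    f g = refl
  sumWords-+ (suc m) f g = trans
    (cong₂ _+_ (sumWords-+ m (f ∘ (false ∷_)) (g ∘ (false ∷_))) (sumWords-+ m (f ∘ (true ∷_)) (g ∘ (true ∷_))))
    (+-interchange (sumWords m (f ∘ (false ∷_))) (sumWords m (g ∘ (false ∷_))) _ _)

  sumWords-*ˡ : ∀ m c (f : Word m → ℕ) → sumWords m (λ v → c * f v) ≡ c * sumWords m f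
  sumWords-*ˡ zero    c f = refl
  sumWords-*ˡ (suc m) c f = trans
    (cong₂ _+_ (sumWords-*ˡ m c (f ∘ (false ∷_))) (sumWords-*ˡ m c (f ∘ (true ∷_))))
    (sym (*-distribˡ-+ c _ _))

  sumWords-zero : ∀ m → sumWords m (λ _ → 0) ≡ 0
  sumWords-zero zero    = refl
  sumWords-zero (suc m) = cong₂ _+_ (sumWords-zero m) (sumWords-zero m)

  term≤sumWords : ∀ m (f : Word m → ℕ) v → f v ≤ sumWords m f
  term≤sumWords zero    f []          = ≤-refl
  term≤sumWords (suc m) f (false ∷ v) = ≤-trans (term≤sumWords m (f ∘ (false ∷_)) v) (m≤m+n _ _)
  term≤sumWords (suc m) f (true ∷ v)  = ≤-trans (term≤sumWords m (f ∘ (true ∷_)) v) (m≤n+m _ _)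

  sumWords-comm : ∀ m k (f : Word m → Word k → ℕ) →
                  sumWords m (λ u → sumWords k (f u)) ≡ sumWords k (λ v → sumWords m (λ u → f u v))
  sumWords-comm zero    k f = refl
  sumWords-comm (suc m) k f = trans
    (cong₂ _+_ (sumWords-comm m k (f ∘ (false ∷_))) (sumWords-comm m k (f ∘ (true ∷_))))
    (sym (sumWords-+ k _ _))

  𝟙>0⇒≡true : ∀ {b} → 0 < 𝟙 b → b ≡ true
  𝟙>0⇒≡true {true} _ = refl

  sumWords>0⇒∃ : ∀ m (p : Word m → Bool) → 0 < sumWords m (𝟙 ∘ p) → ∃[ v ] p v ≡ true
  sumWords>0⇒∃ zero    p pos = [] , 𝟙>0⇒≡true pos
  sumWords>0⇒∃ (suc m) p pos with sumWords m (𝟙 ∘ p ∘ (false ∷_)) in eq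
  ... | zero  = let v , pv = sumWords>0⇒∃ m (p ∘ (true ∷_)) pos in true ∷ v , pv
  ... | suc _ = let v , pv = sumWords>0⇒∃ m (p ∘ (false ∷_)) (subst (0 <_) (sym eq) z<s) in false ∷ v , pv

  allWords-complete : ∀ (v : Word m) → v ∈ allWords m
  allWords-complete []          = here refl
  allWords-complete (false ∷ v) = ∈-++⁺ˡ (∈-map⁺ (false ∷_) (allWords-complete v))
  allWords-complete (true ∷ v)  = ∈-++⁺ʳ _ (∈-map⁺ (true ∷_) (allWords-complete v))

  sum-map-allWords : ∀ m (f : Word m → ℕ) → sum (map f (allWords m)) ≡ sumWords m f
  sum-map-allWords zero    f = +-identityʳ (f [])
  sum-map-allWords (suc m) f = begin
    sum (map f (map (false ∷_) ws ++ map (true ∷_) ws))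
      ≡⟨ cong sum (map-++ f (map (false ∷_) ws) _) ⟩
    sum (map f (map (false ∷_) ws) ++ map f (map (true ∷_) ws))
      ≡⟨ sum-++ (map f (map (false ∷_) ws)) _ ⟩
    sum (map f (map (false ∷_) ws)) + sum (map f (map (true ∷_) ws))
      ≡⟨ cong₂ _+_ (cong sum (map-∘ ws)) (cong sum (map-∘ ws)) ⟨
    sum (map (f ∘ (false ∷_)) ws) + sum (map (f ∘ (true ∷_)) ws)
      ≡⟨ cong₂ _+_ (sum-map-allWords m _) (sum-map-allWords m _) ⟩
    sumWords (suc m) f ∎
    where
    open ≡-Reasoning
    ws = allWords m

  length-filter≡sum-𝟙 : ∀ {A : Set} (p : A → Bool) xs → length (filter (T? ∘ p) xs) ≡ sum (map (𝟙 ∘ p) xs)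
  length-filter≡sum-𝟙 p []       = refl
  length-filter≡sum-𝟙 p (x ∷ xs) with p x
  ... | true  = cong suc (length-filter≡sum-𝟙 p xs)
  ... | false = length-filter≡sum-𝟙 p xs

  any-allWords⁺ : ∀ (p : Word m → Bool) v → p v ≡ true → any p (allWords m) ≡ true
  any-allWords⁺ p v pv = Equivalence.to T-≡ (any⁺ p (lose (allWords-complete v) (Equivalence.from T-≡ pv)))

  any-allWords⁻ : ∀ (p : Word m → Bool) → any p (allWords m) ≡ true → ∃[ v ] p v ≡ true
  any-allWords⁻ {m} p any-p with satisfied (any⁻ p (allWords m) (Equivalence.from T-≡ any-p))
  ... | v , pv = v , Equivalence.to T-≡ pv

  argmaxWords : ∀ m (f : Word m → ℕ) → ∃[ v ] (∀ u → f u ≤ f v)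
  argmaxWords m f = argmax f (replicate m false) (allWords m) ,
    λ u → All.lookup (f[xs]≤f[argmax] {f = f} (replicate m false) (allWords m)) (allWords-complete u)

  Subset : ℕ → Set
  Subset m = Word m → Bool

  _⊆_ : Subset m → Subset m → Set
  S ⊆ T = ∀ v → S v ≡ true → T v ≡ true

  ∣_∣ : Subset m → ℕ
  ∣_∣ {m} S = sumWords m (𝟙 ∘ S)

  card≡∣∣ : ∀ d (S : VSet d) → card d S ≡ ∣ S ∣
  card≡∣∣ d S = trans (length-filter≡sum-𝟙 S (allWords (dim d))) (sum-map-allWords (dim d) (𝟙 ∘ S))

  ∧-intro : ∀ {a b} → a ≡ true → b ≡ true → a ∧ b ≡ true
  ∧-intro refl refl = refl

  ∧-elimˡ : ∀ {a b} → a ∧ b ≡ true → a ≡ true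
  ∧-elimˡ {true} _ = refl

  ∧-elimʳ : ∀ {a b} → a ∧ b ≡ true → b ≡ true
  ∧-elimʳ {true} b≡true = b≡true

  Γ : (Word m → Word m → Bool) → Subset m → Subset m
  Γ {m} E S v = any (λ u → S u ∧ E u v) (allWords m)

  deg : (Word m → Word m → Bool) → Word m → ℕ
  deg {m} E u = sumWords m (λ v → 𝟙 (E u v))

  Γ-intro : ∀ (E : Word m → Word m → Bool) {S u v} → S u ≡ true → E u v ≡ true → Γ E S v ≡ true
  Γ-intro E {u = u} Su Euv = any-allWords⁺ _ u (∧-intro Su Euv)

  Γ-elim : ∀ (E : Word m → Word m → Bool) {S v} → Γ E S v ≡ true → ∃[ u ] S u ≡ true × E u v ≡ true
  Γ-elim E {S} v∈ΓS with any-allWords⁻ _ v∈ΓS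
  ... | u , Su∧Euv = u , ∧-elimˡ Su∧Euv , ∧-elimʳ {S u} Su∧Euv

  Γ-mono : ∀ (E : Word m → Word m → Bool) {S T} → S ⊆ T → Γ E S ⊆ Γ E T
  Γ-mono E S⊆T v v∈ΓS with Γ-elim E v∈ΓS
  ... | u , Su , Euv = Γ-intro E (S⊆T u Su) Euv

  hamming-refl : ∀ (v : Word m) → hamming v v ≡ 0
  hamming-refl []          = refl
  hamming-refl (false ∷ v) = hamming-refl v
  hamming-refl (true ∷ v)  = hamming-refl v

  hamming-sym : ∀ (u v : Word m) → hamming u v ≡ hamming v u
  hamming-sym []          []          = refl
  hamming-sym (false ∷ u) (false ∷ v) = hamming-sym u v
  hamming-sym (false ∷ u) (true ∷ v)  = cong suc (hamming-sym u v)
  hamming-sym (true ∷ u)  (false ∷ v) = cong suc (hamming-sym u v)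
  hamming-sym (true ∷ u)  (true ∷ v)  = hamming-sym u v

  hamming≡0⇒≡ : ∀ (u v : Word m) → (hamming u v ≡ᵇ 0) ≡ true → u ≡ v
  hamming≡0⇒≡ []          []          _ = refl
  hamming≡0⇒≡ (false ∷ u) (false ∷ v) h = cong (false ∷_) (hamming≡0⇒≡ u v h)
  hamming≡0⇒≡ (true ∷ u)  (true ∷ v)  h = cong (true ∷_) (hamming≡0⇒≡ u v h)

  weight≤length : ∀ (v : Word m) → weight v ≤ m
  weight≤length []          = z≤n
  weight≤length (false ∷ v) = m≤n⇒m≤1+n (weight≤length v)
  weight≤length (true ∷ v)  = s≤s (weight≤length v)

  sumWords-hamming≡0 : ∀ (v : Word m) (p : Word m → Bool) →
                       sumWords m (λ u → 𝟙 ((hamming v u ≡ᵇ 0) ∧ p u)) ≡ 𝟙 (p v)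
  sumWords-hamming≡0 []                  p = refl
  sumWords-hamming≡0 {suc m} (false ∷ v) p =
    trans (cong₂ _+_ (sumWords-hamming≡0 v (p ∘ (false ∷_))) (sumWords-zero m)) (+-identityʳ _)
  sumWords-hamming≡0 {suc m} (true ∷ v)  p =
    cong₂ _+_ (sumWords-zero m) (sumWords-hamming≡0 v (p ∘ (true ∷_)))

  n*f[1+[n∸1]]≡n*f[n] : ∀ n (f : ℕ → ℕ) → n * f (suc (n ∸ 1)) ≡ n * f n
  n*f[1+[n∸1]]≡n*f[n] zero    f = refl
  n*f[1+[n∸1]]≡n*f[n] (suc n) f = refl

  -- Neighbours of v are obtained by raising one of its m − |v| zeros or lowering one of its |v| ones.
  sumWords-hamming≡1 : ∀ (v : Word m) (P : ℕ → Bool) →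
    sumWords m (λ u → 𝟙 ((hamming v u ≡ᵇ 1) ∧ P (weight u)))
      ≡ (m ∸ weight v) * 𝟙 (P (suc (weight v))) + weight v * 𝟙 (P (weight v ∸ 1))
  sumWords-hamming≡1 []                  P = refl
  sumWords-hamming≡1 {suc m} (false ∷ v) P
    rewrite sumWords-hamming≡1 v P | sumWords-hamming≡0 v (P ∘ suc ∘ weight) | +-∸-assoc 1 (weight≤length v) =
    solve 3 (λ x y a → x :* a :+ y :+ a := a :+ x :* a :+ y) refl
      (m ∸ weight v) (weight v * 𝟙 (P (weight v ∸ 1))) (𝟙 (P (suc (weight v))))
  sumWords-hamming≡1 {suc m} (true ∷ v)  P
    rewrite sumWords-hamming≡0 v (P ∘ weight) | sumWords-hamming≡1 v (P ∘ suc)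
          | n*f[1+[n∸1]]≡n*f[n] (weight v) (𝟙 ∘ P) =
    solve 3 (λ a x w → a :+ (x :+ w :* a) := x :+ (a :+ w :* a)) refl
      (𝟙 (P (weight v))) ((m ∸ weight v) * 𝟙 (P (suc (suc (weight v))))) (weight v)

  ∅ : Subset m
  ∅ _ = false

  ❴_❵ : Word m → Subset m
  ❴ y ❵ v = hamming y v ≡ᵇ 0

  _∪_ : Subset m → Subset m → Subset m
  (S ∪ T) v = S v ∨ T v

  ∣∅∣ : ∣ ∅ {m} ∣ ≡ 0
  ∣∅∣ {m} = sumWords-zero m

  ∣❴_❵∣ : ∀ (y : Word m) → ∣ ❴ y ❵ ∣ ≡ 1
  ∣❴_❵∣ {m} y =
    trans (sumWords-cong m (λ v → cong 𝟙 (sym (∧-identityʳ _)))) (sumWords-hamming≡0 y (λ _ → true))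

  ∣∪∣≤ : ∀ (S T : Subset m) → ∣ S ∪ T ∣ ≤ ∣ S ∣ + ∣ T ∣
  ∣∪∣≤ {m} S T = ≤-trans (sumWords-mono-≤ m (λ v → 𝟙-∨ (S v) (T v))) (≤-reflexive (sumWords-+ m _ _))
    where
    𝟙-∨ : ∀ a b → 𝟙 (a ∨ b) ≤ 𝟙 a + 𝟙 b
    𝟙-∨ true  _ = s≤s z≤n
    𝟙-∨ false _ = ≤-refl

  ∈-∪⁻ : ∀ (S T : Subset m) {v} → (S ∪ T) v ≡ true → S v ≡ true ⊎ T v ≡ true
  ∈-∪⁻ S T {v} with S v
  ... | true  = λ _ → inj₁ refl
  ... | false = inj₂

  ∈-∪⁺ˡ : ∀ (S T : Subset m) {v} → S v ≡ true → (S ∪ T) v ≡ true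
  ∈-∪⁺ˡ S T Sv rewrite Sv = refl

  ∈-∪⁺ʳ : ∀ (S T : Subset m) {v} → T v ≡ true → (S ∪ T) v ≡ true
  ∈-∪⁺ʳ S T {v} Tv with S v
  ... | true  = refl
  ... | false = Tv

module MiddleLayers where

  open import Function using (_∘_)
  open import Function.Bundles using (Equivalence)
  open import Data.Bool using (Bool; true; false; _∧_; if_then_else_)
  open import Data.Bool.Properties using (T-≡; ∧-comm)
  open import Data.Nat
  open import Data.Nat.Properties
  open import Data.Product using (_,_)
  open import Data.Sum using (_⊎_; inj₁; inj₂)
  open import Relation.Binary.PropositionalEquality
  open import Relation.Nullary.Decidable using (dec-true; dec-false)
  open import Defs using (Word; weight; hamming; dim; inV; adj; VSet; V; N; Sub)
  open Cube

  ≡ᵇ-true : ∀ {m n} → m ≡ n → (m ≡ᵇ n) ≡ true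
  ≡ᵇ-true = dec-true (_ ≟ _)

  ≡ᵇ-false : ∀ {m n} → m ≢ n → (m ≡ᵇ n) ≡ false
  ≡ᵇ-false = dec-false (_ ≟ _)

  middleWeight : ℕ → ℕ → Bool
  middleWeight d w = if w ≡ᵇ (d ∸ 1) then true else (w ≡ᵇ d)

  𝟙-middleWeight-lower : ∀ e → 𝟙 (middleWeight (suc e) e) ≡ 1
  𝟙-middleWeight-lower e rewrite ≡ᵇ-true (refl {x = e}) = refl

  𝟙-middleWeight-upper : ∀ e → 𝟙 (middleWeight (suc e) (suc e)) ≡ 1
  𝟙-middleWeight-upper e rewrite ≡ᵇ-false (1+n≢n {e}) | ≡ᵇ-true (refl {x = e}) = refl

  𝟙-middleWeight-above : ∀ e → 𝟙 (middleWeight (suc e) (suc (suc e))) ≡ 0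
  𝟙-middleWeight-above e rewrite ≡ᵇ-false (<⇒≢ (m≤n⇒m≤1+n (n<1+n e)) ∘ sym) | ≡ᵇ-false (1+n≢n {e}) = refl

  𝟙-middleWeight-below : ∀ e → e * 𝟙 (middleWeight (suc e) (e ∸ 1)) ≡ 0
  𝟙-middleWeight-below zero    = refl
  𝟙-middleWeight-below (suc f)
    rewrite ≡ᵇ-false (1+n≢n {f} ∘ sym) | ≡ᵇ-false (<⇒≢ (m≤n⇒m≤1+n (n<1+n f))) = *-zeroʳ (suc f)

  dim-suc : ∀ e → dim (suc e) ≡ e + suc e
  dim-suc e = cong (e +_) (+-identityʳ (suc e))

  inV-weight : ∀ e (v : Word (dim (suc e))) → inV (suc e) v ≡ true → weight v ≡ e ⊎ weight v ≡ suc e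
  inV-weight e v v∈V with weight v ≡ᵇ e in w≡e
  ... | true  = inj₁ (≡ᵇ⇒≡ _ _ (Equivalence.from T-≡ w≡e))
  ... | false = inj₂ (≡ᵇ⇒≡ _ _ (Equivalence.from T-≡ v∈V))

  adj-sym : ∀ d (u v : Word (dim d)) → adj d u v ≡ adj d v u
  adj-sym d u v rewrite hamming-sym u v with inV d u | inV d v
  ... | false | false = refl
  ... | false | true  = refl
  ... | true  | false = refl
  ... | true  | true  = refl

  deg-adj-inV : ∀ e (v : Word (dim (suc e))) → inV (suc e) v ≡ true → deg (adj (suc e)) v ≡ suc e
  deg-adj-inV e v v∈V = begin
    deg (adj (suc e)) v
      ≡⟨ sumWords-cong (dim (suc e)) 𝟙-adj ⟩
    sumWords (dim (suc e)) (λ u → 𝟙 ((hamming v u ≡ᵇ 1) ∧ middleWeight (suc e) (weight u)))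
      ≡⟨ sumWords-hamming≡1 v (middleWeight (suc e)) ⟩
    (dim (suc e) ∸ weight v) * 𝟙 (middleWeight (suc e) (suc (weight v)))
      + weight v * 𝟙 (middleWeight (suc e) (weight v ∸ 1))
      ≡⟨ by-layer (inV-weight e v v∈V) ⟩
    suc e ∎
    where
    open ≡-Reasoning
    𝟙-adj : ∀ u → 𝟙 (adj (suc e) v u) ≡ 𝟙 ((hamming v u ≡ᵇ 1) ∧ middleWeight (suc e) (weight u))
    𝟙-adj u = cong 𝟙 (trans (cong (_∧ (inV (suc e) u ∧ (hamming v u ≡ᵇ 1))) v∈V) (∧-comm (inV (suc e) u) _))
    by-layer : weight v ≡ e ⊎ weight v ≡ suc e →
      (dim (suc e) ∸ weight v) * 𝟙 (middleWeight (suc e) (suc (weight v)))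
        + weight v * 𝟙 (middleWeight (suc e) (weight v ∸ 1)) ≡ suc e
    by-layer (inj₁ w≡e)
      rewrite w≡e | dim-suc e | m+n∸m≡n e (suc e) | 𝟙-middleWeight-upper e | 𝟙-middleWeight-below e =
      trans (+-identityʳ _) (*-identityʳ (suc e))
    by-layer (inj₂ w≡1+e)
      rewrite w≡1+e | dim-suc e | m+n∸n≡m e (suc e) | 𝟙-middleWeight-above e | 𝟙-middleWeight-lower e =
      cong₂ _+_ (*-zeroʳ e) (*-identityʳ (suc e))

  deg-adj-≤ : ∀ e (v : Word (dim (suc e))) → deg (adj (suc e)) v ≤ suc e
  deg-adj-≤ e v = by-membership (inV (suc e) v) refl
    where
    by-membership : ∀ b → inV (suc e) v ≡ b → deg (adj (suc e)) v ≤ suc e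
    by-membership true  v∈V = ≤-reflexive (deg-adj-inV e v v∈V)
    by-membership false v∉V =
      ≤-trans (≤-reflexive (trans (sumWords-cong (dim (suc e)) 𝟙-adj) (sumWords-zero (dim (suc e))))) z≤n
      where
      𝟙-adj : ∀ u → 𝟙 (adj (suc e) v u) ≡ 0
      𝟙-adj u = cong (λ b → 𝟙 (b ∧ (inV (suc e) u ∧ (hamming v u ≡ᵇ 1)))) v∉V

  N⊆V : ∀ d (S : VSet d) → Sub d (N d S) (V d)
  N⊆V d S v v∈NS with Γ-elim (adj d) {S} {v} v∈NS
  ... | u , _ , adj-uv = ∧-elimˡ (∧-elimʳ {inV d u} adj-uv)

module Covering where

  open import Function using (_∘_)
  open import Data.Bool using (Bool; true; false; _∧_; not)
  open import Data.Nat
  open import Data.Nat.Properties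
  open import Data.Nat.DivMod using (_/_; m*[n/m]≡n)
  open import Data.Nat.Divisibility using (m∣m*n; ∣-trans; m≤n⇒m!∣n!)
  open import Data.Nat.Induction using (<-wellFounded)
  open import Data.Nat.Solver using (module +-*-Solver)
  open import Induction.WellFounded using (Acc; acc)
  open import Data.Product using (∃-syntax; _×_; _,_)
  open import Data.Sum using (inj₁; inj₂)
  open import Relation.Binary.PropositionalEquality
  open import Relation.Nullary using (contradiction; yes; no)
  open import Defs using (Word)
  open Cube
  open +-*-Solver using (solve; _:+_; _:*_; _:=_; con)

  -- Δ! · H_a; the divisions are exact as long as a ≤ Δ.
  scaledHarmonic : ℕ → ℕ → ℕ
  scaledHarmonic Δ zero    = 0
  scaledHarmonic Δ (suc a) = scaledHarmonic Δ a + Δ ! / suc a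

  [1+a]*[Δ!/[1+a]]≡Δ! : ∀ Δ a → suc a ≤ Δ → suc a * (Δ ! / suc a) ≡ Δ !
  [1+a]*[Δ!/[1+a]]≡Δ! Δ a 1+a≤Δ = m*[n/m]≡n (∣-trans (m∣m*n (a !)) (m≤n⇒m!∣n! 1+a≤Δ))

  module _ (Δ : ℕ) where

    private
      H : ℕ → ℕ
      H = scaledHarmonic Δ

    scaledHarmonic-mono-≤ : ∀ {a b} → a ≤ b → H a ≤ H b
    scaledHarmonic-mono-≤ {a} a≤b with m≤n⇒∃[o]m+o≡n a≤b
    ... | o , refl = H[a]≤H[a+o] a o
      where
      H[a]≤H[a+o] : ∀ a o → H a ≤ H (a + o)
      H[a]≤H[a+o] a zero    rewrite +-identityʳ a = ≤-refl
      H[a]≤H[a+o] a (suc o) rewrite +-suc a o = ≤-trans (H[a]≤H[a+o] a o) (m≤m+n _ _)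

    -- Each of the b steps from a to a + b adds Δ!/j ≥ Δ!/c.
    scaledHarmonic-+ : ∀ c a b → a + b ≤ c → a + b ≤ Δ → c * H a + Δ ! * b ≤ c * H (a + b)
    scaledHarmonic-+ c a zero _ _ rewrite *-zeroʳ (Δ !) | +-identityʳ (c * H a) | +-identityʳ a = ≤-refl
    scaledHarmonic-+ c a (suc b) a+1+b≤c a+1+b≤Δ = begin
      c * H a + Δ ! * suc b
        ≡⟨ solve 3 (λ x L b → x :+ L :* (con 1 :+ b) := x :+ L :+ L :* b) refl (c * H a) (Δ !) b ⟩
      c * H a + Δ ! + Δ ! * b
        ≡⟨ cong (λ x → c * H a + x + Δ ! * b) ([1+a]*[Δ!/[1+a]]≡Δ! Δ a (1+a≤ a+1+b≤Δ)) ⟨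
      c * H a + suc a * (Δ ! / suc a) + Δ ! * b
        ≤⟨ +-monoˡ-≤ (Δ ! * b) (+-monoʳ-≤ (c * H a) (*-monoˡ-≤ (Δ ! / suc a) (1+a≤ a+1+b≤c))) ⟩
      c * H a + c * (Δ ! / suc a) + Δ ! * b   ≡⟨ cong (_+ Δ ! * b) (*-distribˡ-+ c (H a) _) ⟨
      c * H (suc a) + Δ ! * b                 ≤⟨ scaledHarmonic-+ c (suc a) b (1+a+b≤ a+1+b≤c) (1+a+b≤ a+1+b≤Δ) ⟩
      c * H (suc a + b)                       ≡⟨ cong (λ n → c * H n) (+-suc a b) ⟨
      c * H (a + suc b)                       ∎
      where
      open ≤-Reasoning
      1+a+b≤ : ∀ {n} → a + suc b ≤ n → suc a + b ≤ n
      1+a+b≤ = ≤-trans (≤-reflexive (sym (+-suc a b)))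
      1+a≤ : ∀ {n} → a + suc b ≤ n → suc a ≤ n
      1+a≤ = ≤-trans (s≤s (m≤m+n a b)) ∘ 1+a+b≤

  module Greedy
    {m : ℕ} (E : Word m → Word m → Bool) (E-sym : ∀ u v → E u v ≡ E v u)
    {δ Δ : ℕ} (1≤δ : 1 ≤ δ) (deg≤Δ : ∀ v → deg E v ≤ Δ)
    (X : Subset m) (δ≤deg : ∀ x → X x ≡ true → δ ≤ deg E x)
    where

    private
      H : ℕ → ℕ
      H = scaledHarmonic Δ

    codeg : Subset m → Word m → ℕ
    codeg U y = sumWords m (λ x → 𝟙 (U x ∧ E x y))

    Ψ : Subset m → ℕ
    Ψ U = sumWords m (λ y → H (codeg U y))

    codeg≤Δ : ∀ U y → codeg U y ≤ Δ
    codeg≤Δ U y = begin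
      codeg U y                      ≤⟨ sumWords-mono-≤ m (λ x → 𝟙-∧ (U x) (E x y)) ⟩
      sumWords m (λ x → 𝟙 (E x y))   ≡⟨ sumWords-cong m (λ x → cong 𝟙 (E-sym x y)) ⟩
      deg E y                        ≤⟨ deg≤Δ y ⟩
      Δ                              ∎
      where
      open ≤-Reasoning
      𝟙-∧ : ∀ a b → 𝟙 (a ∧ b) ≤ 𝟙 b
      𝟙-∧ true  b = ≤-refl
      𝟙-∧ false b = z≤n

    δ*∣U∣≤sum-codeg : ∀ U → U ⊆ X → δ * ∣ U ∣ ≤ sumWords m (codeg U)
    δ*∣U∣≤sum-codeg U U⊆X = begin
      δ * ∣ U ∣                                               ≡⟨ sumWords-*ˡ m δ (𝟙 ∘ U) ⟨
      sumWords m (λ x → δ * 𝟙 (U x))                          ≤⟨ sumWords-mono-≤ m δ*𝟙≤ ⟩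
      sumWords m (λ x → sumWords m (λ y → 𝟙 (U x ∧ E x y)))   ≡⟨ sumWords-comm m m _ ⟩
      sumWords m (codeg U)                                    ∎
      where
      open ≤-Reasoning
      δ*𝟙≤ : ∀ x → δ * 𝟙 (U x) ≤ sumWords m (λ y → 𝟙 (U x ∧ E x y))
      δ*𝟙≤ x with U x in Ux
      ... | true  = ≤-trans (≤-reflexive (*-identityʳ δ)) (δ≤deg x (U⊆X x Ux))
      ... | false = ≤-reflexive (trans (*-zeroʳ δ) (sym (sumWords-zero m)))

    record Cover (U : Subset m) : Set where
      field
        Y          : Subset m
        Y⊆ΓX       : Y ⊆ Γ E X
        U⊆ΓY       : U ⊆ Γ E Y
        Δ!*δ*∣Y∣≤Ψ : Δ ! * δ * ∣ Y ∣ ≤ Ψ U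

    module Step (U : Subset m) (U⊆X : U ⊆ X) (y₀ : Word m) (y₀-max : ∀ y → codeg U y ≤ codeg U y₀) where

      W U′ : Subset m
      W  x = U x ∧ E x y₀
      U′ x = U x ∧ not (E x y₀)

      W⊆X : W ⊆ X
      W⊆X x Wx = U⊆X x (∧-elimˡ Wx)

      U′⊆X : U′ ⊆ X
      U′⊆X x U′x = U⊆X x (∧-elimˡ U′x)

      codeg-split : ∀ y → codeg U y ≡ codeg U′ y + codeg W y
      codeg-split y = trans (sumWords-cong m (λ x → 𝟙-split (U x) (E x y₀) (E x y))) (sumWords-+ m _ _)
        where
        𝟙-split : ∀ a b c → 𝟙 (a ∧ c) ≡ 𝟙 ((a ∧ not b) ∧ c) + 𝟙 ((a ∧ b) ∧ c)
        𝟙-split false _     _ = refl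
        𝟙-split true  false c = sym (+-identityʳ (𝟙 c))
        𝟙-split true  true  c = refl

      U-empty : codeg U y₀ ≡ 0 → ∀ x → U x ≢ true
      U-empty c≡0 x Ux with sumWords>0⇒∃ m (E x) (≤-trans 1≤δ (δ≤deg x (U⊆X x Ux)))
      ... | y , Exy = contradiction (subst (1 ≤_) c≡0 (≤-trans 1≤codeg (y₀-max y))) λ ()
        where
        1≤codeg : 1 ≤ codeg U y
        1≤codeg = ≤-trans (≤-reflexive (cong 𝟙 (sym (∧-intro Ux Exy)))) (term≤sumWords m _ x)

      Ψ-drop : 0 < codeg U y₀ → Ψ U′ + Δ ! * δ ≤ Ψ U
      Ψ-drop c>0 = *-cancelˡ-≤ c {{>-nonZero c>0}} (begin
        c * (Ψ U′ + Δ ! * δ)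
          ≡⟨ solve 4 (λ c Ψ′ L δ → c :* (Ψ′ :+ L :* δ) := c :* Ψ′ :+ L :* (δ :* c))
                   refl c (Ψ U′) (Δ !) δ ⟩
        c * Ψ U′ + Δ ! * (δ * ∣ W ∣)
          ≤⟨ +-monoʳ-≤ (c * Ψ U′) (*-monoʳ-≤ (Δ !) (δ*∣U∣≤sum-codeg W W⊆X)) ⟩
        c * Ψ U′ + Δ ! * sumWords m (codeg W)
          ≡⟨ cong₂ _+_ (sumWords-*ˡ m c _) (sumWords-*ˡ m (Δ !) _) ⟨
        sumWords m (λ y → c * H (codeg U′ y)) + sumWords m (λ y → Δ ! * codeg W y)
          ≡⟨ sumWords-+ m _ _ ⟨
        sumWords m (λ y → c * H (codeg U′ y) + Δ ! * codeg W y)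
          ≤⟨ sumWords-mono-≤ m gain ⟩
        sumWords m (λ y → c * H (codeg U y))
          ≡⟨ sumWords-*ˡ m c _ ⟩
        c * Ψ U ∎)
        where
        open ≤-Reasoning
        c = codeg U y₀
        gain : ∀ y → c * H (codeg U′ y) + Δ ! * codeg W y ≤ c * H (codeg U y)
        gain y rewrite codeg-split y = scaledHarmonic-+ Δ c (codeg U′ y) (codeg W y)
          (subst (_≤ c) (codeg-split y) (y₀-max y)) (subst (_≤ Δ) (codeg-split y) (codeg≤Δ U y))

      Ψ-decreasing : 0 < codeg U y₀ → Ψ U′ < Ψ U
      Ψ-decreasing c>0 = <-≤-trans (m<m+n (Ψ U′) (*-mono-≤ (1≤n! Δ) 1≤δ)) (Ψ-drop c>0)

      extend : 0 < codeg U y₀ → Cover U′ → Cover U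
      extend c>0 cover′ = record { Y = Y ; Y⊆ΓX = Y⊆ΓX ; U⊆ΓY = U⊆ΓY ; Δ!*δ*∣Y∣≤Ψ = Δ!*δ*∣Y∣≤Ψ }
        where
        open Cover cover′ renaming (Y to Y′; Y⊆ΓX to Y′⊆ΓX; U⊆ΓY to U′⊆ΓY′; Δ!*δ*∣Y∣≤Ψ to Δ!*δ*∣Y′∣≤Ψ)

        Y : Subset m
        Y = Y′ ∪ ❴ y₀ ❵

        y₀∈ΓX : Γ E X y₀ ≡ true
        y₀∈ΓX with sumWords>0⇒∃ m W c>0
        ... | x , Wx = Γ-intro E (W⊆X x Wx) (∧-elimʳ {U x} Wx)

        Y⊆ΓX : Y ⊆ Γ E X
        Y⊆ΓX v Yv with ∈-∪⁻ Y′ ❴ y₀ ❵ Yv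
        ... | inj₁ Y′v  = Y′⊆ΓX v Y′v
        ... | inj₂ v≡y₀ = subst (λ u → Γ E X u ≡ true) (hamming≡0⇒≡ y₀ v v≡y₀) y₀∈ΓX

        U⊆ΓY : U ⊆ Γ E Y
        U⊆ΓY x Ux with E x y₀ in Exy₀
        ... | true  = Γ-intro E (∈-∪⁺ʳ Y′ ❴ y₀ ❵ (cong (_≡ᵇ 0) (hamming-refl y₀)))
                                (trans (E-sym y₀ x) Exy₀)
        ... | false = Γ-mono E (λ v → ∈-∪⁺ˡ Y′ ❴ y₀ ❵) x (U′⊆ΓY′ x (∧-intro Ux (cong not Exy₀)))

        Δ!*δ*∣Y∣≤Ψ : Δ ! * δ * ∣ Y ∣ ≤ Ψ U
        Δ!*δ*∣Y∣≤Ψ = begin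
          Δ ! * δ * ∣ Y ∣                    ≤⟨ *-monoʳ-≤ (Δ ! * δ) (∣∪∣≤ Y′ ❴ y₀ ❵) ⟩
          Δ ! * δ * (∣ Y′ ∣ + ∣ ❴ y₀ ❵ ∣)    ≡⟨ cong (λ n → Δ ! * δ * (∣ Y′ ∣ + n)) ∣❴ y₀ ❵∣ ⟩
          Δ ! * δ * (∣ Y′ ∣ + 1)             ≡⟨ *-distribˡ-+ (Δ ! * δ) ∣ Y′ ∣ 1 ⟩
          Δ ! * δ * ∣ Y′ ∣ + Δ ! * δ * 1     ≡⟨ cong (Δ ! * δ * ∣ Y′ ∣ +_) (*-identityʳ (Δ ! * δ)) ⟩
          Δ ! * δ * ∣ Y′ ∣ + Δ ! * δ         ≤⟨ +-monoˡ-≤ (Δ ! * δ) Δ!*δ*∣Y′∣≤Ψ ⟩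
          Ψ U′ + Δ ! * δ                     ≤⟨ Ψ-drop c>0 ⟩
          Ψ U                                ∎
          where open ≤-Reasoning

    cover : ∀ U → U ⊆ X → Acc _<_ (Ψ U) → Cover U
    cover U U⊆X (acc rec) with argmaxWords m (codeg U)
    ... | y₀ , y₀-max with codeg U y₀ ≟ 0
    ...   | yes c≡0 = record
      { Y = ∅ ; Y⊆ΓX = λ _ () ; U⊆ΓY = λ x Ux → contradiction Ux (U-empty c≡0 x)
      ; Δ!*δ*∣Y∣≤Ψ = ≤-trans (≤-reflexive (trans (cong (Δ ! * δ *_) (∣∅∣ {m})) (*-zeroʳ (Δ ! * δ)))) z≤n }
      where open Step U U⊆X y₀ y₀-max
    ...   | no c≢0 = extend (n≢0⇒n>0 c≢0) (cover U′ U′⊆X (rec (Ψ-decreasing (n≢0⇒n>0 c≢0))))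
      where open Step U U⊆X y₀ y₀-max

    codeg-outside : ∀ y → Γ E X y ≡ false → codeg X y ≡ 0
    codeg-outside y y∉ΓX with codeg X y in c≡
    ... | zero  = refl
    ... | suc _ with sumWords>0⇒∃ m (λ x → X x ∧ E x y) (subst (0 <_) (sym c≡) z<s)
    ...   | x , Xx∧Exy =
      contradiction (trans (sym (Γ-intro E (∧-elimˡ Xx∧Exy) (∧-elimʳ {X x} Xx∧Exy))) y∉ΓX) λ ()

    Ψ[X]≤ : Ψ X ≤ ∣ Γ E X ∣ * H Δ
    Ψ[X]≤ = begin
      Ψ X                                    ≤⟨ sumWords-mono-≤ m H[codeg]≤ ⟩
      sumWords m (λ y → H Δ * 𝟙 (Γ E X y))   ≡⟨ sumWords-*ˡ m (H Δ) _ ⟩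
      H Δ * ∣ Γ E X ∣                        ≡⟨ *-comm (H Δ) _ ⟩
      ∣ Γ E X ∣ * H Δ                        ∎
      where
      open ≤-Reasoning
      H[codeg]≤ : ∀ y → H (codeg X y) ≤ H Δ * 𝟙 (Γ E X y)
      H[codeg]≤ y with Γ E X y in y∈ΓX
      ... | true  = ≤-trans (scaledHarmonic-mono-≤ Δ (codeg≤Δ X y)) (≤-reflexive (sym (*-identityʳ _)))
      ... | false = ≤-trans (≤-reflexive (cong H (codeg-outside y y∈ΓX))) z≤n

    greedy-cover : ∃[ Y ] Y ⊆ Γ E X × X ⊆ Γ E Y × Δ ! * δ * ∣ Y ∣ ≤ ∣ Γ E X ∣ * scaledHarmonic Δ Δ
    greedy-cover = Y , Y⊆ΓX , U⊆ΓY , ≤-trans Δ!*δ*∣Y∣≤Ψ Ψ[X]≤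
      where open Cover (cover X (λ _ Xx → Xx) (<-wellFounded (Ψ X)))

module ExpSeries where

  open import Function using (_∘_)
  open import Data.Nat as ℕ using (ℕ; zero; suc; _!; _∸_)
  import Data.Nat.Properties as ℕ
  import Data.Nat.Coprimality as Coprimality
  import Data.Integer as ℤ
  import Data.Integer.Properties as ℤ
  open import Data.Sum using (inj₁; inj₂)
  open import Data.Rational
  open import Data.Rational.Properties
  open import Data.Rational.Solver using (module +-*-Solver)
  open import Algebra.Bundles using (CommutativeRing; CommutativeMonoid)
  open import Algebra.Properties.CommutativeSemiring.Exp (CommutativeRing.commutativeSemiring +-*-commutativeRing)
    using (_^_)
  open import Algebra.Properties.CommutativeSemigroup (CommutativeMonoid.commutativeSemigroup +-0-commutativeMonoid)
    using () renaming (interchange to +-interchange)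
  open import Algebra.Properties.CommutativeSemigroup (CommutativeMonoid.commutativeSemigroup *-1-commutativeMonoid)
    using () renaming (x∙yz≈y∙xz to *-left-commutative)
  open import Relation.Binary.PropositionalEquality using (_≡_; refl; sym; trans; cong; cong₂; subst; subst₂)
  open import Defs using (expPartial; LeOnePlusLn)
  open Covering using (scaledHarmonic; [1+a]*[Δ!/[1+a]]≡Δ!)
  open +-*-Solver using (solve; _:+_; _:*_; _:-_; _:=_; con)
  open ≤-Reasoning

  -- Built with mkℚ rather than as + n / 1, so that its numerator and denominator compute.
  ι : ℕ → ℚ
  ι n = mkℚ (ℤ.+ n) 0 (Coprimality.sym (Coprimality.1-coprimeTo n))

  /1≡ι : ∀ n → ℤ.+ n / 1 ≡ ι n
  /1≡ι n = ↥p/↧p≡p (ι n)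

  ι-+ : ∀ m n → ι (m ℕ.+ n) ≡ ι m + ι n
  ι-+ m n = sym (trans (/-cong eq refl) (/1≡ι (m ℕ.+ n)))
    where
    eq : ℤ.+ m ℤ.* ℤ.+ 1 ℤ.+ ℤ.+ n ℤ.* ℤ.+ 1 ≡ ℤ.+ (m ℕ.+ n)
    eq = trans (cong₂ ℤ._+_ (ℤ.*-identityʳ (ℤ.+ m)) (ℤ.*-identityʳ (ℤ.+ n))) (sym (ℤ.pos-+ m n))

  ι-* : ∀ m n → ι (m ℕ.* n) ≡ ι m * ι n
  ι-* m n = sym (trans (/-cong (sym (ℤ.pos-* m n)) refl) (/1≡ι (m ℕ.* n)))

  ι-^ : ∀ m n → ι (m ℕ.^ n) ≡ ι m ^ n
  ι-^ m zero = refl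
  ι-^ m (suc n) = trans (ι-* m (m ℕ.^ n)) (cong (ι m *_) (ι-^ m n))

  ι-mono-≤ : ∀ {m n} → m ℕ.≤ n → ι m ≤ ι n
  ι-mono-≤ {m} {n} m≤n =
    *≤* (subst₂ ℤ._≤_ (sym (ℤ.*-identityʳ (ℤ.+ m))) (sym (ℤ.*-identityʳ (ℤ.+ n))) (ℤ.+≤+ m≤n))

  /≡ι*1/ι : ∀ a b .{{_ : ℕ.NonZero b}} → ℤ.+ a / b ≡ ι a * 1/ ι b
  /≡ι*1/ι a (suc b) = /-cong (sym (ℤ.*-identityʳ (ℤ.+ a))) (sym (ℕ.*-identityˡ (suc b)))

  1/ι-* : ∀ m n .{{_ : ℕ.NonZero m}} .{{_ : ℕ.NonZero n}} →
          (1/ ι (m ℕ.* n)) {{ℕ.m*n≢0 m n}} ≡ 1/ ι m * 1/ ι n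
  1/ι-* (suc m) (suc n) = sym (↥p/↧p≡p (1/ ι (suc m ℕ.* suc n)))

  1/ι! : ℕ → ℚ
  1/ι! j = (1/ ι (j !)) {{j ℕ.!≢0}}

  ι-suc-cancel : ∀ n {p q} → ι (suc n) * p ≡ ι (suc n) * q → p ≡ q
  ι-suc-cancel n {p} {q} eq = begin-equality
      p                          ≡⟨ sym (*-identityˡ p) ⟩
      1ℚ * p                     ≡⟨ cong (_* p) (sym (*-inverseˡ a)) ⟩
      1/ a * a * p               ≡⟨ *-assoc (1/ a) a p ⟩
      1/ a * (a * p)             ≡⟨ cong (1/ a *_) eq ⟩
      1/ a * (a * q)             ≡⟨ sym (*-assoc (1/ a) a q) ⟩
      1/ a * a * q               ≡⟨ cong (_* q) (*-inverseˡ a) ⟩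
      1ℚ * q                     ≡⟨ *-identityˡ q ⟩
      q                          ∎
    where a = ι (suc n)

  0≤ι : ∀ n → 0ℚ ≤ ι n
  0≤ι n = ι-mono-≤ ℕ.z≤n

  0≤1/ι : ∀ n .{{_ : ℕ.NonZero n}} → 0ℚ ≤ 1/ ι n
  0≤1/ι (suc n) = *≤* (ℤ.+≤+ ℕ.z≤n)

  0≤1/ι! : ∀ n → 0ℚ ≤ 1/ι! n
  0≤1/ι! n = 0≤1/ι (n !) {{n ℕ.!≢0}}

  1/ι≤1 : ∀ n → 1/ ι (suc n) ≤ 1ℚ
  1/ι≤1 n = *≤* (ℤ.+≤+ (ℕ.s≤s ℕ.z≤n))

  *-nonNeg : ∀ {p q} → 0ℚ ≤ p → 0ℚ ≤ q → 0ℚ ≤ p * q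
  *-nonNeg {p} {q} 0≤p 0≤q =
    nonNegative⁻¹ (p * q) {{nonNeg*nonNeg⇒nonNeg p {{nonNegative 0≤p}} q {{nonNegative 0≤q}}}}

  *-mono-≤-nonNeg : ∀ {p q r s} → 0ℚ ≤ p → 0ℚ ≤ r → p ≤ q → r ≤ s → p * r ≤ q * s
  *-mono-≤-nonNeg {p} {q} {r} {s} 0≤p 0≤r p≤q r≤s = begin
    p * r ≤⟨ *-monoʳ-≤-nonNeg r {{nonNegative 0≤r}} p≤q ⟩
    q * r ≤⟨ *-monoˡ-≤-nonNeg q {{nonNegative (≤-trans 0≤p p≤q)}} r≤s ⟩
    q * s ∎

  ^-nonNeg : ∀ {p} → 0ℚ ≤ p → ∀ n → 0ℚ ≤ p ^ n
  ^-nonNeg 0≤p zero = *≤* (ℤ.+≤+ ℕ.z≤n)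
  ^-nonNeg 0≤p (suc n) = *-nonNeg 0≤p (^-nonNeg 0≤p n)

  ^-mono-≤ : ∀ {p q} → 0ℚ ≤ p → p ≤ q → ∀ n → p ^ n ≤ q ^ n
  ^-mono-≤ 0≤p p≤q zero = ≤-refl
  ^-mono-≤ 0≤p p≤q (suc n) = *-mono-≤-nonNeg 0≤p (^-nonNeg 0≤p n) p≤q (^-mono-≤ 0≤p p≤q n)

  sumTo : ℕ → (ℕ → ℚ) → ℚ
  sumTo zero    f = f 0
  sumTo (suc N) f = f 0 + sumTo N (f ∘ suc)

  sumTo-cong : ∀ N {f g : ℕ → ℚ} → (∀ i → f i ≡ g i) → sumTo N f ≡ sumTo N g
  sumTo-cong zero    f≡g = f≡g 0
  sumTo-cong (suc N) f≡g = cong₂ _+_ (f≡g 0) (sumTo-cong N (f≡g ∘ suc))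

  sumTo-mono-≤ : ∀ N {f g : ℕ → ℚ} → (∀ i → f i ≤ g i) → sumTo N f ≤ sumTo N g
  sumTo-mono-≤ zero    f≤g = f≤g 0
  sumTo-mono-≤ (suc N) f≤g = +-mono-≤ (f≤g 0) (sumTo-mono-≤ N (f≤g ∘ suc))

  sumTo-nonNeg : ∀ N {f : ℕ → ℚ} → (∀ i → 0ℚ ≤ f i) → 0ℚ ≤ sumTo N f
  sumTo-nonNeg zero    0≤f = 0≤f 0
  sumTo-nonNeg (suc N) 0≤f = +-mono-≤ (0≤f 0) (sumTo-nonNeg N (0≤f ∘ suc))

  sumTo-≤-suc : ∀ N {f : ℕ → ℚ} → (∀ i → 0ℚ ≤ f i) → sumTo N f ≤ sumTo (suc N) f
  sumTo-≤-suc zero    {f} 0≤f = begin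
    f 0        ≡⟨ +-identityʳ (f 0) ⟨
    f 0 + 0ℚ   ≤⟨ +-monoʳ-≤ (f 0) (0≤f 1) ⟩
    f 0 + f 1  ∎
  sumTo-≤-suc (suc N) {f} 0≤f = +-monoʳ-≤ (f 0) (sumTo-≤-suc N (0≤f ∘ suc))

  sumTo-last : ∀ N (f : ℕ → ℚ) → sumTo (suc N) f ≡ sumTo N f + f (suc N)
  sumTo-last zero    f = refl
  sumTo-last (suc N) f = trans (cong (f 0 +_) (sumTo-last N (f ∘ suc))) (sym (+-assoc (f 0) _ _))

  sumTo-+ : ∀ N (f g : ℕ → ℚ) → sumTo N (λ i → f i + g i) ≡ sumTo N f + sumTo N g
  sumTo-+ zero    f g = refl
  sumTo-+ (suc N) f g = trans (cong (f 0 + g 0 +_) (sumTo-+ N (f ∘ suc) (g ∘ suc)))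
    (+-interchange (f 0) (g 0) _ _)

  sumTo-*ˡ : ∀ N c (f : ℕ → ℚ) → sumTo N (λ i → c * f i) ≡ c * sumTo N f
  sumTo-*ˡ zero    c f = refl
  sumTo-*ˡ (suc N) c f =
    trans (cong (c * f 0 +_) (sumTo-*ˡ N c (f ∘ suc))) (sym (*-distribˡ-+ c _ _))

  -- The Cauchy product: (f ⋆ g) N = Σ_{i+j=N} f i · g j.
  infixl 7 _⋆_
  _⋆_ : (ℕ → ℚ) → (ℕ → ℚ) → ℕ → ℚ
  (f ⋆ g) zero    = f 0 * g 0
  (f ⋆ g) (suc N) = f 0 * g (suc N) + (f ∘ suc ⋆ g) N

  ⋆-cong : ∀ {f f′ g g′ : ℕ → ℚ} → (∀ i → f i ≡ f′ i) → (∀ j → g j ≡ g′ j) →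
           ∀ N → (f ⋆ g) N ≡ (f′ ⋆ g′) N
  ⋆-cong f≡ g≡ zero    = cong₂ _*_ (f≡ 0) (g≡ 0)
  ⋆-cong f≡ g≡ (suc N) = cong₂ _+_ (cong₂ _*_ (f≡ 0) (g≡ (suc N))) (⋆-cong (f≡ ∘ suc) g≡ N)

  ⋆-distribʳ-+ : ∀ (f h g : ℕ → ℚ) N → ((λ i → f i + h i) ⋆ g) N ≡ (f ⋆ g) N + (h ⋆ g) N
  ⋆-distribʳ-+ f h g zero    = *-distribʳ-+ (g 0) (f 0) (h 0)
  ⋆-distribʳ-+ f h g (suc N) = trans
    (cong₂ _+_ (*-distribʳ-+ (g (suc N)) (f 0) (h 0)) (⋆-distribʳ-+ (f ∘ suc) (h ∘ suc) g N))
    (+-interchange (f 0 * g (suc N)) (h 0 * g (suc N)) ((f ∘ suc ⋆ g) N) ((h ∘ suc ⋆ g) N))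

  ⋆-*ˡ : ∀ c (f g : ℕ → ℚ) N → ((λ i → c * f i) ⋆ g) N ≡ c * (f ⋆ g) N
  ⋆-*ˡ c f g zero    = *-assoc c (f 0) (g 0)
  ⋆-*ˡ c f g (suc N) = trans (cong₂ _+_ (*-assoc c (f 0) (g (suc N))) (⋆-*ˡ c (f ∘ suc) g N))
    (sym (*-distribˡ-+ c _ _))

  ⋆-*ʳ : ∀ c (f g : ℕ → ℚ) N → (f ⋆ (λ j → c * g j)) N ≡ c * (f ⋆ g) N
  ⋆-*ʳ c f g zero    = *-left-commutative (f 0) c (g 0)
  ⋆-*ʳ c f g (suc N) = trans (cong₂ _+_ (*-left-commutative (f 0) c (g (suc N))) (⋆-*ʳ c (f ∘ suc) g N))
    (sym (*-distribˡ-+ c _ _))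

  ∂ : (ℕ → ℚ) → ℕ → ℚ
  ∂ f i = ι (suc i) * f (suc i)

  ι-suc : ∀ n → ι (suc n) ≡ 1ℚ + ι n
  ι-suc n = ι-+ 1 n

  ⋆-Leibniz : ∀ (f g : ℕ → ℚ) N → ι (suc N) * (f ⋆ g) (suc N) ≡ (∂ f ⋆ g) N + (f ⋆ ∂ g) N
  ⋆-Leibniz f g zero =
    solve 5 (λ a f₀ f₁ g₀ g₁ → a :* (f₀ :* g₁ :+ f₁ :* g₀) := a :* f₁ :* g₀ :+ f₀ :* (a :* g₁))
      refl (ι 1) (f 0) (f 1) (g 0) (g 1)
  ⋆-Leibniz f g (suc N) = begin-equality
    ι (suc (suc N)) * (f 0 * G + P)
      ≡⟨ cong (λ b → b * (f 0 * G + P)) (ι-suc (suc N)) ⟩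
    (1ℚ + a) * (f 0 * G + P)
      ≡⟨ solve 4 (λ a f₀ G P → (con 1ℚ :+ a) :* (f₀ :* G :+ P)
                               := f₀ :* ((con 1ℚ :+ a) :* G) :+ P :+ a :* P) refl a (f 0) G P ⟩
    f 0 * ((1ℚ + a) * G) + P + a * P
      ≡⟨ cong₂ (λ b Q → f 0 * (b * G) + P + Q) (sym (ι-suc (suc N))) (⋆-Leibniz (f ∘ suc) g N) ⟩
    f 0 * (ι (suc (suc N)) * G) + (f 1 * g (suc N) + C) + (A + B)
      ≡⟨ solve 6 (λ X f₁ g₁ C A B → X :+ (f₁ :* g₁ :+ C) :+ (A :+ B)
                                   := con 1ℚ :* f₁ :* g₁ :+ (A :+ C) :+ (X :+ B))
           refl (f 0 * (ι (suc (suc N)) * G)) (f 1) (g (suc N)) C A B ⟩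
    ι 1 * f 1 * g (suc N) + (A + C) + (f 0 * (ι (suc (suc N)) * G) + B)
      ≡⟨ cong (λ D → ι 1 * f 1 * g (suc N) + D + (f 0 * (ι (suc (suc N)) * G) + B)) ∂-shift ⟨
    (∂ f ⋆ g) (suc N) + (f ⋆ ∂ g) (suc N) ∎
    where
    a = ι (suc N)
    G = g (suc (suc N))
    P = (f ∘ suc ⋆ g) (suc N)
    A = (∂ (f ∘ suc) ⋆ g) N
    B = (f ∘ suc ⋆ ∂ g) N
    C = (f ∘ suc ∘ suc ⋆ g) N
    ∂-shift : (∂ f ∘ suc ⋆ g) N ≡ A + C
    ∂-shift = trans (⋆-cong ∂-suc (λ _ → refl) N) (⋆-distribʳ-+ (∂ (f ∘ suc)) (f ∘ suc ∘ suc) g N)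
      where
      ∂-suc : ∀ i → ∂ f (suc i) ≡ ∂ (f ∘ suc) i + f (suc (suc i))
      ∂-suc i = trans (cong (_* f (suc (suc i))) (ι-suc (suc i)))
        (solve 2 (λ a x → (con 1ℚ :+ a) :* x := a :* x :+ x) refl (ι (suc i)) (f (suc (suc i))))

  expTerm : ℚ → ℕ → ℚ
  expTerm x j = x ^ j * 1/ι! j

  ∂-expTerm : ∀ x j → ∂ (expTerm x) j ≡ x * expTerm x j
  ∂-expTerm x j = begin-equality
    ι (suc j) * (x * x ^ j * 1/ι! (suc j))
      ≡⟨ cong (λ r → ι (suc j) * (x * x ^ j * r)) (1/ι-* (suc j) (j !) {{_}} {{j ℕ.!≢0}}) ⟩
    ι (suc j) * (x * x ^ j * (1/ ι (suc j) * 1/ι! j))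
      ≡⟨ solve 5 (λ a r x y s → a :* (x :* y :* (r :* s)) := a :* r :* (x :* (y :* s)))
           refl (ι (suc j)) (1/ ι (suc j)) x (x ^ j) (1/ι! j) ⟩
    ι (suc j) * 1/ ι (suc j) * (x * expTerm x j)
      ≡⟨ cong (_* (x * expTerm x j)) (*-inverseʳ (ι (suc j))) ⟩
    1ℚ * (x * expTerm x j)
      ≡⟨ *-identityˡ _ ⟩
    x * expTerm x j ∎

  expTerm-nonNeg : ∀ {x} → 0ℚ ≤ x → ∀ j → 0ℚ ≤ expTerm x j
  expTerm-nonNeg 0≤x j = *-nonNeg (^-nonNeg 0≤x j) (0≤1/ι! j)

  expTerm-mono-≤ : ∀ {x y} → 0ℚ ≤ x → x ≤ y → ∀ j → expTerm x j ≤ expTerm y j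
  expTerm-mono-≤ 0≤x x≤y j = *-monoʳ-≤-nonNeg (1/ι! j) {{nonNegative (0≤1/ι! j)}} (^-mono-≤ 0≤x x≤y j)

  expTerm-binomial : ∀ x y N → (expTerm x ⋆ expTerm y) N ≡ expTerm (x + y) N
  expTerm-binomial x y zero    = refl
  expTerm-binomial x y (suc N) = ι-suc-cancel N (begin-equality
    ι (suc N) * (expTerm x ⋆ expTerm y) (suc N)
      ≡⟨ ⋆-Leibniz (expTerm x) (expTerm y) N ⟩
    (∂ (expTerm x) ⋆ expTerm y) N + (expTerm x ⋆ ∂ (expTerm y)) N
      ≡⟨ cong₂ _+_ (trans (⋆-cong (∂-expTerm x) (λ _ → refl) N) (⋆-*ˡ x (expTerm x) (expTerm y) N))
                   (trans (⋆-cong (λ _ → refl) (∂-expTerm y) N) (⋆-*ʳ y (expTerm x) (expTerm y) N)) ⟩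
    x * (expTerm x ⋆ expTerm y) N + y * (expTerm x ⋆ expTerm y) N
      ≡⟨ *-distribʳ-+ _ x y ⟨
    (x + y) * (expTerm x ⋆ expTerm y) N
      ≡⟨ cong ((x + y) *_) (expTerm-binomial x y N) ⟩
    (x + y) * expTerm (x + y) N
      ≡⟨ ∂-expTerm (x + y) N ⟨
    ι (suc N) * expTerm (x + y) (suc N) ∎)

  sumTo-⋆-≤ : ∀ N (f g : ℕ → ℚ) → (∀ i → 0ℚ ≤ f i) → (∀ j → 0ℚ ≤ g j) →
              sumTo N (f ⋆ g) ≤ sumTo N f * sumTo N g
  sumTo-⋆-≤ zero    f g 0≤f 0≤g = ≤-refl
  sumTo-⋆-≤ (suc N) f g 0≤f 0≤g = begin
    f 0 * g 0 + sumTo N (λ M → f 0 * g (suc M) + (f ∘ suc ⋆ g) M)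
      ≡⟨ cong (f 0 * g 0 +_) (trans (sumTo-+ N _ _)
                                     (cong (_+ sumTo N (f ∘ suc ⋆ g)) (sumTo-*ˡ N (f 0) (g ∘ suc)))) ⟩
    f 0 * g 0 + (f 0 * sumTo N (g ∘ suc) + sumTo N (f ∘ suc ⋆ g))
      ≡⟨ solve 4 (λ f₀ g₀ S T → f₀ :* g₀ :+ (f₀ :* S :+ T) := f₀ :* (g₀ :+ S) :+ T) refl (f 0) (g 0) _ _ ⟩
    f 0 * sumTo (suc N) g + sumTo N (f ∘ suc ⋆ g)
      ≤⟨ +-monoʳ-≤ (f 0 * sumTo (suc N) g) (sumTo-⋆-≤ N (f ∘ suc) g (0≤f ∘ suc) 0≤g) ⟩
    f 0 * sumTo (suc N) g + sumTo N (f ∘ suc) * sumTo N g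
      ≤⟨ +-monoʳ-≤ (f 0 * sumTo (suc N) g)
           (*-monoˡ-≤-nonNeg (sumTo N (f ∘ suc)) {{nonNegative (sumTo-nonNeg N (0≤f ∘ suc))}}
                              (sumTo-≤-suc N 0≤g)) ⟩
    f 0 * sumTo (suc N) g + sumTo N (f ∘ suc) * sumTo (suc N) g
      ≡⟨ *-distribʳ-+ (sumTo (suc N) g) (f 0) _ ⟨
    sumTo (suc N) f * sumTo (suc N) g ∎

  expSum : ℚ → ℕ → ℚ
  expSum x N = sumTo N (expTerm x)

  expSum-nonNeg : ∀ {x} → 0ℚ ≤ x → ∀ N → 0ℚ ≤ expSum x N
  expSum-nonNeg 0≤x N = sumTo-nonNeg N (expTerm-nonNeg 0≤x)

  expSum-mono-≤ : ∀ {x y} → 0ℚ ≤ x → x ≤ y → ∀ N → expSum x N ≤ expSum y N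
  expSum-mono-≤ 0≤x x≤y N = sumTo-mono-≤ N (expTerm-mono-≤ 0≤x x≤y)

  expSum-+-≤ : ∀ {x y} → 0ℚ ≤ x → 0ℚ ≤ y → ∀ N → expSum (x + y) N ≤ expSum x N * expSum y N
  expSum-+-≤ {x} {y} 0≤x 0≤y N = begin
    expSum (x + y) N                  ≡⟨ sumTo-cong N (expTerm-binomial x y) ⟨
    sumTo N (expTerm x ⋆ expTerm y)   ≤⟨ sumTo-⋆-≤ N _ _ (expTerm-nonNeg 0≤x) (expTerm-nonNeg 0≤y) ⟩
    expSum x N * expSum y N           ∎

  expTerm-suc-≤ : ∀ {x} → 0ℚ ≤ x → ∀ j → expTerm x (suc j) ≤ x * expTerm x j
  expTerm-suc-≤ {x} 0≤x j = begin
    expTerm x (suc j)              ≡⟨ *-identityˡ _ ⟨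
    1ℚ * expTerm x (suc j)         ≤⟨ *-monoʳ-≤-nonNeg (expTerm x (suc j)) {{nonNegative (expTerm-nonNeg 0≤x (suc j))}}
                                        (ι-mono-≤ (ℕ.s≤s ℕ.z≤n)) ⟩
    ι (suc j) * expTerm x (suc j)  ≡⟨ ∂-expTerm x j ⟩
    x * expTerm x j                ∎

  expSum-suc-≤ : ∀ {x} → 0ℚ ≤ x → ∀ N → expSum x (suc N) ≤ 1ℚ + x * expSum x N
  expSum-suc-≤ {x} 0≤x N = +-monoʳ-≤ 1ℚ (begin
    sumTo N (expTerm x ∘ suc)          ≤⟨ sumTo-mono-≤ N (expTerm-suc-≤ 0≤x) ⟩
    sumTo N (λ j → x * expTerm x j)    ≡⟨ sumTo-*ˡ N x (expTerm x) ⟩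
    x * expSum x N                     ∎)

  expSum-geometric : ∀ {x} → 0ℚ ≤ x → x ≤ 1ℚ → ∀ N → (1ℚ - x) * expSum x N ≤ 1ℚ
  expSum-geometric {x} 0≤x x≤1 zero = begin
    (1ℚ - x) * 1ℚ   ≡⟨ *-identityʳ (1ℚ - x) ⟩
    1ℚ - x          ≤⟨ +-monoʳ-≤ 1ℚ (neg-antimono-≤ 0≤x) ⟩
    1ℚ - 0ℚ         ≡⟨⟩
    1ℚ              ∎
  expSum-geometric {x} 0≤x x≤1 (suc N) = begin
    (1ℚ - x) * expSum x (suc N)
      ≤⟨ *-monoˡ-≤-nonNeg (1ℚ - x) {{nonNegative 0≤1-x}} (expSum-suc-≤ 0≤x N) ⟩
    (1ℚ - x) * (1ℚ + x * expSum x N)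
      ≡⟨ solve 2 (λ x E → (con 1ℚ :- x) :* (con 1ℚ :+ x :* E) := con 1ℚ :- x :+ x :* ((con 1ℚ :- x) :* E))
           refl x (expSum x N) ⟩
    1ℚ - x + x * ((1ℚ - x) * expSum x N)
      ≤⟨ +-monoʳ-≤ (1ℚ - x) (*-monoˡ-≤-nonNeg x {{nonNegative 0≤x}} (expSum-geometric 0≤x x≤1 N)) ⟩
    1ℚ - x + x * 1ℚ
      ≡⟨ solve 1 (λ x → con 1ℚ :- x :+ x :* con 1ℚ := con 1ℚ) refl x ⟩
    1ℚ ∎
    where
    0≤1-x : 0ℚ ≤ 1ℚ - x
    0≤1-x = begin
      0ℚ      ≡⟨ +-inverseʳ x ⟨
      x - x   ≤⟨ +-monoˡ-≤ (- x) x≤1 ⟩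
      1ℚ - x  ∎

  expSum-zero-≤ : ∀ N → expSum 0ℚ N ≤ 1ℚ
  expSum-zero-≤ N = subst (_≤ 1ℚ) (*-identityˡ (expSum 0ℚ N)) (expSum-geometric ≤-refl (0≤ι 1) N)

  expSum-ι*-≤ : ∀ {x} → 0ℚ ≤ x → ∀ n N → expSum (ι n * x) N ≤ expSum x N ^ n
  expSum-ι*-≤ {x} 0≤x zero N = subst (λ y → expSum y N ≤ 1ℚ) (sym (*-zeroˡ x)) (expSum-zero-≤ N)
  expSum-ι*-≤ {x} 0≤x (suc n) N = begin
    expSum (ι (suc n) * x) N           ≡⟨ cong (λ y → expSum y N) ι-suc-* ⟩
    expSum (x + ι n * x) N             ≤⟨ expSum-+-≤ 0≤x (*-nonNeg (0≤ι n) 0≤x) N ⟩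
    expSum x N * expSum (ι n * x) N
      ≤⟨ *-monoˡ-≤-nonNeg (expSum x N) {{nonNegative (expSum-nonNeg 0≤x N)}} (expSum-ι*-≤ 0≤x n N) ⟩
    expSum x N * expSum x N ^ n        ∎
    where
    ι-suc-* : ι (suc n) * x ≡ x + ι n * x
    ι-suc-* = trans (cong (_* x) (ι-suc n)) (solve 2 (λ a x → (con 1ℚ :+ a) :* x := x :+ a :* x) refl (ι n) x)

  harmonic : ℕ → ℚ
  harmonic zero    = 0ℚ
  harmonic (suc n) = harmonic n + 1/ ι (suc n)

  harmonic-1-suc : ∀ m → harmonic (suc (suc m)) - 1ℚ ≡ (harmonic (suc m) - 1ℚ) + 1/ ι (suc (suc m))
  harmonic-1-suc m =
    solve 2 (λ h r → h :+ r :- con 1ℚ := h :- con 1ℚ :+ r) refl (harmonic (suc m)) (1/ ι (suc (suc m)))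

  0≤harmonic-1 : ∀ m → 0ℚ ≤ harmonic (suc m) - 1ℚ
  0≤harmonic-1 zero    = ≤-refl
  0≤harmonic-1 (suc m) =
    subst (0ℚ ≤_) (sym (harmonic-1-suc m)) (+-mono-≤ (0≤harmonic-1 m) (0≤1/ι (suc (suc m))))

  [1+m]*expSum[1/[2+m]]≤2+m : ∀ m N → ι (suc m) * expSum (1/ ι (suc (suc m))) N ≤ ι (suc (suc m))
  [1+m]*expSum[1/[2+m]]≤2+m m N = begin
    ι (suc m) * expSum r N                      ≡⟨ cong (_* expSum r N) 1+m≡[2+m]*[1-r] ⟩
    ι (suc (suc m)) * (1ℚ - r) * expSum r N     ≡⟨ *-assoc (ι (suc (suc m))) (1ℚ - r) (expSum r N) ⟩
    ι (suc (suc m)) * ((1ℚ - r) * expSum r N)   ≤⟨ *-monoˡ-≤-nonNeg (ι (suc (suc m))) {{nonNegative (0≤ι _)}}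
                                                     (expSum-geometric (0≤1/ι (suc (suc m))) (1/ι≤1 (suc m)) N) ⟩
    ι (suc (suc m)) * 1ℚ                        ≡⟨ *-identityʳ _ ⟩
    ι (suc (suc m))                             ∎
    where
    r = 1/ ι (suc (suc m))
    1+m≡[2+m]*[1-r] : ι (suc m) ≡ ι (suc (suc m)) * (1ℚ - r)
    1+m≡[2+m]*[1-r] = begin-equality
      ι (suc m)                               ≡⟨ solve 1 (λ a → a := con 1ℚ :+ a :- con 1ℚ) refl (ι (suc m)) ⟩
      1ℚ + ι (suc m) - 1ℚ                     ≡⟨ cong₂ _-_ (ι-suc (suc m)) (*-inverseʳ (ι (suc (suc m)))) ⟨
      ι (suc (suc m)) - ι (suc (suc m)) * r
        ≡⟨ solve 2 (λ a r → a :- a :* r := a :* (con 1ℚ :- r)) refl (ι (suc (suc m))) r ⟩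
      ι (suc (suc m)) * (1ℚ - r)              ∎

  expSum[harmonic-1]≤ : ∀ m N → expSum (harmonic (suc m) - 1ℚ) N ≤ ι (suc m)
  expSum[harmonic-1]≤ zero    N = expSum-zero-≤ N
  expSum[harmonic-1]≤ (suc m) N = begin
    expSum (harmonic (suc (suc m)) - 1ℚ) N   ≡⟨ cong (λ y → expSum y N) (harmonic-1-suc m) ⟩
    expSum (G + r) N                         ≤⟨ expSum-+-≤ (0≤harmonic-1 m) 0≤r N ⟩
    expSum G N * expSum r N                  ≤⟨ *-monoʳ-≤-nonNeg (expSum r N) {{nonNegative (expSum-nonNeg 0≤r N)}}
                                                  (expSum[harmonic-1]≤ m N) ⟩
    ι (suc m) * expSum r N                   ≤⟨ [1+m]*expSum[1/[2+m]]≤2+m m N ⟩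
    ι (suc (suc m))                          ∎
    where
    G = harmonic (suc m) - 1ℚ
    r = 1/ ι (suc (suc m))
    0≤r = 0≤1/ι (suc (suc m))

  expTerm-ι : ∀ k j → expTerm (ι k) j ≡ (ℤ.+ (k ℕ.^ j) / j !) {{j ℕ.!≢0}}
  expTerm-ι k j = trans (cong (_* 1/ι! j) (sym (ι-^ k j))) (sym (/≡ι*1/ι (k ℕ.^ j) (j !) {{j ℕ.!≢0}}))

  expPartial≡expSum : ∀ k N → expPartial k N ≡ expSum (ι k) N
  expPartial≡expSum k zero    = refl
  expPartial≡expSum k (suc N) = begin-equality
    expPartial k (suc N)                       ≡⟨ cong₂ _+_ (expPartial≡expSum k N) (sym (expTerm-ι k (suc N))) ⟩
    expSum (ι k) N + expTerm (ι k) (suc N)     ≡⟨ sumTo-last N (expTerm (ι k)) ⟨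
    expSum (ι k) (suc N)  ∎

  ι-∸-≤ : ∀ K n h → 0ℚ ≤ h - 1ℚ → ι K ≤ ι n * h → ι (K ∸ n) ≤ ι n * (h - 1ℚ)
  ι-∸-≤ K n h 0≤h-1 K≤nh with ℕ.≤-total K n
  ... | inj₁ K≤n = subst (_≤ ι n * (h - 1ℚ)) (cong ι (sym (ℕ.m≤n⇒m∸n≡0 K≤n))) (*-nonNeg (0≤ι n) 0≤h-1)
  ... | inj₂ n≤K = begin
    ι (K ∸ n)                     ≡⟨ solve 2 (λ a b → a := a :+ b :- b) refl (ι (K ∸ n)) (ι n) ⟩
    ι (K ∸ n) + ι n - ι n         ≡⟨ cong (_- ι n) (trans (sym (ι-+ (K ∸ n) n)) (cong ι (ℕ.m∸n+n≡m n≤K))) ⟩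
    ι K - ι n                     ≤⟨ +-monoˡ-≤ (- ι n) K≤nh ⟩
    ι n * h - ι n                 ≡⟨ solve 2 (λ a h → a :* h :- a := a :* (h :- con 1ℚ)) refl (ι n) h ⟩
    ι n * (h - 1ℚ)                ∎

  harmonic-bound⇒LeOnePlusLn : ∀ K n m → ι K ≤ ι n * harmonic (suc m) → LeOnePlusLn K n (suc m)
  harmonic-bound⇒LeOnePlusLn K n m K≤nH N = begin
    expPartial (K ∸ n) N      ≡⟨ expPartial≡expSum (K ∸ n) N ⟩
    expSum (ι (K ∸ n)) N      ≤⟨ expSum-mono-≤ (0≤ι (K ∸ n)) (ι-∸-≤ K n (harmonic (suc m)) 0≤G K≤nH) N ⟩
    expSum (ι n * G) N        ≤⟨ expSum-ι*-≤ 0≤G n N ⟩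
    expSum G N ^ n            ≤⟨ ^-mono-≤ (expSum-nonNeg 0≤G N) (expSum[harmonic-1]≤ m N) n ⟩
    ι (suc m) ^ n             ≡⟨ ι-^ (suc m) n ⟨
    ι (suc m ℕ.^ n)           ≡⟨ /1≡ι (suc m ℕ.^ n) ⟨
    ℤ.+ (suc m ℕ.^ n) / 1     ∎
    where
    G = harmonic (suc m) - 1ℚ
    0≤G = 0≤harmonic-1 m

  ι-scaledHarmonic : ∀ Δ a → a ℕ.≤ Δ → ι (scaledHarmonic Δ a) ≡ ι (Δ !) * harmonic a
  ι-scaledHarmonic Δ zero    _     = sym (*-zeroʳ (ι (Δ !)))
  ι-scaledHarmonic Δ (suc a) 1+a≤Δ = begin-equality
    ι (scaledHarmonic Δ a ℕ.+ Δ ! ℕ./ suc a)            ≡⟨ ι-+ (scaledHarmonic Δ a) _ ⟩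
    ι (scaledHarmonic Δ a) + ι (Δ ! ℕ./ suc a)
      ≡⟨ cong₂ _+_ (ι-scaledHarmonic Δ a (ℕ.<⇒≤ 1+a≤Δ)) ι[Δ!/[1+a]] ⟩
    ι (Δ !) * harmonic a + ι (Δ !) * 1/ ι (suc a)      ≡⟨ *-distribˡ-+ (ι (Δ !)) (harmonic a) (1/ ι (suc a)) ⟨
    ι (Δ !) * harmonic (suc a)                         ∎
    where
    ι[Δ!/[1+a]] : ι (Δ ! ℕ./ suc a) ≡ ι (Δ !) * 1/ ι (suc a)
    ι[Δ!/[1+a]] = ι-suc-cancel a (begin-equality
      ι (suc a) * ι (Δ ! ℕ./ suc a)           ≡⟨ ι-* (suc a) _ ⟨
      ι (suc a ℕ.* (Δ ! ℕ./ suc a))           ≡⟨ cong ι ([1+a]*[Δ!/[1+a]]≡Δ! Δ a 1+a≤Δ) ⟩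
      ι (Δ !)                                 ≡⟨ *-identityʳ (ι (Δ !)) ⟨
      ι (Δ !) * 1ℚ                            ≡⟨ cong (ι (Δ !) *_) (*-inverseʳ (ι (suc a))) ⟨
      ι (Δ !) * (ι (suc a) * 1/ ι (suc a))    ≡⟨ *-left-commutative (ι (Δ !)) (ι (suc a)) (1/ ι (suc a)) ⟩
      ι (suc a) * (ι (Δ !) * 1/ ι (suc a))    ∎)

  ι-cancelˡ-≤ : ∀ c .{{_ : ℕ.NonZero c}} {p q} → ι c * p ≤ ι c * q → p ≤ q
  ι-cancelˡ-≤ (suc c) = *-cancelˡ-≤-pos (ι (suc c))

  scaledHarmonic-bound⇒LeOnePlusLn : ∀ K n m → let d = suc m in
    d ! ℕ.* K ℕ.≤ n ℕ.* scaledHarmonic d d → LeOnePlusLn K n d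
  scaledHarmonic-bound⇒LeOnePlusLn K n m bound =
    harmonic-bound⇒LeOnePlusLn K n m (ι-cancelˡ-≤ (d !) {{d ℕ.!≢0}} (begin
      ι (d !) * ι K                      ≡⟨ ι-* (d !) K ⟨
      ι (d ! ℕ.* K)                      ≤⟨ ι-mono-≤ bound ⟩
      ι (n ℕ.* scaledHarmonic d d)       ≡⟨ ι-* n _ ⟩
      ι n * ι (scaledHarmonic d d)       ≡⟨ cong (ι n *_) (ι-scaledHarmonic d d ℕ.≤-refl) ⟩
      ι n * (ι (d !) * harmonic d)       ≡⟨ *-left-commutative (ι n) (ι (d !)) (harmonic d) ⟩
      ι (d !) * (ι n * harmonic d)       ∎))
    where d = suc m

open import Function using (_∘_)
open import Data.Nat using (ℕ; suc; _≤_; _*_; _!; s≤s; z≤n)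
open import Data.Nat.Properties using (≤-reflexive; *-assoc; module ≤-Reasoning)
open import Data.Product using (Σ; _×_; _,_)
open import Relation.Binary.PropositionalEquality using (sym; cong)
open import Defs
open Cube using (∣_∣; card≡∣∣)
open MiddleLayers using (adj-sym; deg-adj-≤; deg-adj-inV; N⊆V)
open Covering using (module Greedy; scaledHarmonic)
open ExpSeries using (scaledHarmonic-bound⇒LeOnePlusLn)

corollary3p3 : (d : ℕ) → 1 ≤ d → (X : VSet d) → Sub d X (V d) →
    Σ (VSet d) (λ Y → Sub d Y (V d) × MutuallyCovers d Y X × LeOnePlusLn (d * card d Y) (card d (N d X)) d)
corollary3p3 (suc e) _ X X⊆V =
  let Y , Y⊆NX , X⊆NY , d!*d*∣Y∣≤∣NX∣*H =
        Greedy.greedy-cover (adj d) (adj-sym d) (s≤s z≤n) (deg-adj-≤ e) X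
          (λ x x∈X → ≤-reflexive (sym (deg-adj-inV e x (X⊆V x x∈X))))
  in Y , (λ v → N⊆V d X v ∘ Y⊆NX v) , (X⊆NY , Y⊆NX) ,
     scaledHarmonic-bound⇒LeOnePlusLn (d * card d Y) (card d (N d X)) e (begin
       d ! * (d * card d Y)                  ≡⟨ cong (λ k → d ! * (d * k)) (card≡∣∣ d Y) ⟩
       d ! * (d * ∣ Y ∣)                     ≡⟨ *-assoc (d !) d ∣ Y ∣ ⟨
       d ! * d * ∣ Y ∣                       ≤⟨ d!*d*∣Y∣≤∣NX∣*H ⟩
       ∣ N d X ∣ * scaledHarmonic d d        ≡⟨ cong (_* scaledHarmonic d d) (card≡∣∣ d (N d X)) ⟨
       card d (N d X) * scaledHarmonic d d   ∎)
  where
  d = suc e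
  open ≤-Reasoning
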